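{- Let $\overrightarrow{H}$ be an absolute oriented clique on $n$ vertices, let $x$ be a vertex of $\overrightarrow{H}$, and let $\overrightarrow{H}'$ be the oriented graph obtained from $\overrightarrow{H}$ by pushing $x$. Suppose $\chi_o(\overrightarrow{H}') = n-1$ and that $x' \neq x$ is a vertex non-adjacent to $x$ such that $x$ and $x'$ agree on every common neighbor in $\overrightarrow{H}'$. Then the oriented graph $\overrightarrow{H}'_{(xx')}$ is an absolute oriented clique.
   Context: An oriented graph is a finite directed graph with no loops, no multiple arcs and no directed cycle of length $2$. A homomorphism of an oriented graph $\overrightarrow{G}$ to an oriented graph $\overrightarrow{T}$ is a map $\phi:V(\overrightarrow{G})\to V(\overrightarrow{T})$ such that for every arc $uv$ of $\overrightarrow{G}$, $\phi(u)\phi(v)$ is an arc of $\overrightarrow{T}$. The oriented chromatic number $\chi_o(\overrightarrow{G})$ is the minimum $|V(\overrightarrow{T})|$ over oriented graphs $\overrightarrow{T}$ admitting a homomorphism from $\overrightarrow{G}$. An absolute oriented clique is an oriented graph $\overrightarrow{C}$ with $\chi_o(\overrightarrow{C}) = |V(\overrightarrow{C})|$. To push a vertex $x$ means to reverse the orientation of every arc incident to $x$, leaving all other arcs unchanged. Two vertices $u,v$ agree on a common neighbor $w$ if $w$ is an in-neighbor of both or an out-neighbor of both. For an oriented graph $\overrightarrow{G}$ with two non-adjacent vertices $x,x'$ agreeing on all their common neighbors, $\overrightarrow{G}_{(xx')}$ is the oriented graph obtained by deleting $x$ and $x'$ and adding a new vertex $(xx')$ whose in-neighbors are all in-neighbors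 of $x$ or of $x'$ and whose out-neighbors are all out-neighbors of $x$ or of $x'$. -}

module Defs where

open import Data.Nat using (ℕ; suc; _≤_)
open import Data.Fin using (Fin; punchIn)
open import Data.Product using (Σ; ∃; _×_; _,_)
open import Data.Sum using (_⊎_)
open import Data.Empty using (⊥)
open import Relation.Nullary using (¬_)
open import Relation.Binary.PropositionalEquality using (_≡_; _≢_)

record Digraph (n : ℕ) : Set₁ where
  field
    Arc : Fin n → Fin n → Set
open Digraph public

-- Oriented: no loops, no directed 2-cycles (multiple arcs are impossible
-- since arcs are given by a relation).
record IsOriented {n : ℕ} (G : Digraph n) : Set where
  field
    irrefl : ∀ u → ¬ Arc G u u
    asym   : ∀ u v → Arc G u v → ¬ Arc G v u

IsHom : {n k : ℕ} → Digraph n → Digraph k → (Fin n → Fin k) → Set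
IsHom G T φ = ∀ u v → Arc G u v → Arc T (φ u) (φ v)

Colorable : {n : ℕ} → Digraph n → ℕ → Set₁
Colorable {n} G k =
  Σ (Digraph k) λ T → IsOriented T × Σ (Fin n → Fin k) λ φ → IsHom G T φ

OrientedChromaticNumber : {n : ℕ} → Digraph n → ℕ → Set₁
OrientedChromaticNumber G k = Colorable G k × (∀ m → Colorable G m → k ≤ m)

IsAbsoluteClique : {n : ℕ} → Digraph n → Set₁
IsAbsoluteClique {n} G = IsOriented G × OrientedChromaticNumber G n

Adjacent : {n : ℕ} → Digraph n → Fin n → Fin n → Set
Adjacent G u v = Arc G u v ⊎ Arc G v u

push : {n : ℕ} → Digraph n → Fin n → Digraph n
push G x = record
  { Arc = λ u v → ((u ≡ x ⊎ v ≡ x) × Arc G v u)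
                ⊎ (u ≢ x × v ≢ x × Arc G u v) }

AgreeOnCommon : {n : ℕ} → Digraph n → Fin n → Fin n → Set
AgreeOnCommon G u v = ∀ w → Adjacent G u w → Adjacent G v w →
  (Arc G w u × Arc G w v) ⊎ (Arc G u w × Arc G v w)

-- Merging x and x' (x' ≢ x) in a graph on Fin (suc m): the result has
-- vertex set Fin m, where vertex i stands for the original vertex
-- punchIn x' i (i.e. all vertices except x'), and the vertex standing for
-- x plays the role of the new vertex (xx').  Represents u a : original
-- vertex a is one of the vertices merged into u.
Represents : {n : ℕ} → Fin n → Fin n → Fin n → Fin n → Set
Represents x x' u a = (a ≡ u) ⊎ (u ≡ x × a ≡ x')

merge : {m : ℕ} → Digraph (suc m) → Fin (suc m) → Fin (suc m) → Digraph m
merge G x x' = record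
  { Arc = λ i j → Σ _ λ a → Σ _ λ b →
      Represents x x' (punchIn x' i) a × Represents x x' (punchIn x' j) b
      × Arc G a b }

-- Contracting x' onto x is a homomorphism from H' onto H'_(xx'), so every
-- colouring of H'_(xx') pulls back to a colouring of H' and therefore uses at
-- least χ_o(H') = n - 1 colours; as H'_(xx') has exactly n - 1 vertices, it
-- is an absolute clique once it is oriented.  It is oriented because x and x'
-- are non-adjacent (no loop at (xx')) and agree on their common neighbours (no
-- 2-cycle through (xx')).
module Submission where

open import Defs
open import Data.Nat using (ℕ; suc)
open import Data.Fin using (Fin; punchIn; punchOut; _≟_)
open import Data.Fin.Properties using (punchIn-punchOut)
open import Data.Product using (_×_; _,_)
open import Data.Sum using (_⊎_; inj₁; inj₂)
open import Function using (id; _∘_)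
open import Relation.Nullary using (¬_; yes; no)
open import Relation.Binary.PropositionalEquality using (_≡_; _≢_; refl; sym; trans)

push-isOriented : ∀ {n} {G : Digraph n} → IsOriented G → (x : Fin n) →
                  IsOriented (push G x)
push-isOriented {G = G} oG x = record { irrefl = irrefl′ ; asym = asym′ }
  where
  open IsOriented oG
  irrefl′ : ∀ u → ¬ Arc (push G x) u u
  irrefl′ u (inj₁ (_ , uu))     = irrefl u uu
  irrefl′ u (inj₂ (_ , _ , uu)) = irrefl u uu
  asym′ : ∀ u v → Arc (push G x) u v → ¬ Arc (push G x) v u
  asym′ u v (inj₁ (_ , vu))         (inj₁ (_ , uv))       = asym v u vu uv
  asym′ u v (inj₁ (inj₁ u≡x , _))   (inj₂ (_ , u≢x , _))  = u≢x u≡x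
  asym′ u v (inj₁ (inj₂ v≡x , _))   (inj₂ (v≢x , _ , _))  = v≢x v≡x
  asym′ u v (inj₂ (_ , v≢x , _))    (inj₁ (inj₁ v≡x , _)) = v≢x v≡x
  asym′ u v (inj₂ (u≢x , _ , _))    (inj₁ (inj₂ u≡x , _)) = u≢x u≡x
  asym′ u v (inj₂ (_ , _ , uv))     (inj₂ (_ , _ , vu))   = asym u v uv vu

colorable-self : ∀ {n} {G : Digraph n} → IsOriented G → Colorable G n
colorable-self {G = G} oG = G , oG , id , λ _ _ uv → uv

colorable-precomp : ∀ {n n′ k} {G : Digraph n} {G′ : Digraph n′} {φ : Fin n → Fin n′} →
                    IsHom G G′ φ → Colorable G′ k → Colorable G k
colorable-precomp φ-hom (T , oT , ψ , ψ-hom) =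
  T , oT , ψ ∘ _ , λ u v uv → ψ-hom _ _ (φ-hom u v uv)

module IdentifiedPair {n : ℕ} {G : Digraph n} (oG : IsOriented G) {x x' : Fin n}
         (x≁x' : ¬ Adjacent G x x') (agree : AgreeOnCommon G x x') where
  open IsOriented oG

  InPair : Fin n → Set
  InPair a = a ≡ x ⊎ a ≡ x'

  Identified : Fin n → Fin n → Set
  Identified a a' = a ≡ a' ⊎ (InPair a × InPair a')

  no-arc-within-pair : ∀ {a b} → InPair a → InPair b → ¬ Arc G a b
  no-arc-within-pair (inj₁ refl) (inj₁ refl) xx   = irrefl x xx
  no-arc-within-pair (inj₁ refl) (inj₂ refl) xx'  = x≁x' (inj₁ xx')
  no-arc-within-pair (inj₂ refl) (inj₁ refl) x'x  = x≁x' (inj₂ x'x)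
  no-arc-within-pair (inj₂ refl) (inj₂ refl) x'x' = irrefl x' x'x'

  no-2-cycle-through-pair : ∀ {a b b'} → InPair b → InPair b' →
                            Arc G a b → ¬ Arc G b' a
  no-2-cycle-through-pair (inj₁ refl) (inj₁ refl) ax  xa  = asym _ _ ax xa
  no-2-cycle-through-pair (inj₂ refl) (inj₂ refl) ax' x'a = asym _ _ ax' x'a
  no-2-cycle-through-pair {a} (inj₁ refl) (inj₂ refl) ax x'a
    with agree a (inj₂ ax) (inj₁ x'a)
  ... | inj₁ (_ , ax') = asym _ _ ax' x'a
  ... | inj₂ (xa , _)  = asym _ _ xa ax
  no-2-cycle-through-pair {a} (inj₂ refl) (inj₁ refl) ax' xa
    with agree a (inj₁ xa) (inj₂ ax')
  ... | inj₁ (ax , _)  = asym _ _ ax xa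
  ... | inj₂ (_ , x'a) = asym _ _ x'a ax'

  represents-identified : ∀ {u a a'} → Represents x x' u a → Represents x x' u a' →
                          Identified a a'
  represents-identified (inj₁ a≡u)          (inj₁ a'≡u)          = inj₁ (trans a≡u (sym a'≡u))
  represents-identified (inj₁ a≡u)          (inj₂ (u≡x , a'≡x')) = inj₂ (inj₁ (trans a≡u u≡x) , inj₂ a'≡x')
  represents-identified (inj₂ (u≡x , a≡x')) (inj₁ a'≡u)          = inj₂ (inj₂ a≡x' , inj₁ (trans a'≡u u≡x))
  represents-identified (inj₂ (_ , a≡x'))   (inj₂ (_ , a'≡x'))   = inj₂ (inj₂ a≡x' , inj₂ a'≡x')

  no-arc-identified : ∀ {a b} → Identified a b → ¬ Arc G a b
  no-arc-identified (inj₁ refl)            aa = irrefl _ aa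
  no-arc-identified (inj₂ (a∈xx' , b∈xx')) ab = no-arc-within-pair a∈xx' b∈xx' ab

  no-2-cycle-identified : ∀ {a b a' b'} → Identified a a' → Identified b b' →
                          Arc G a b → ¬ Arc G b' a'
  no-2-cycle-identified (inj₁ refl)        (inj₁ refl)        ab ba   = asym _ _ ab ba
  no-2-cycle-identified (inj₁ refl)        (inj₂ (b∈ , b'∈))  ab b'a  = no-2-cycle-through-pair b∈ b'∈ ab b'a
  no-2-cycle-identified (inj₂ (a∈ , a'∈))  (inj₁ refl)        ab ba'  = no-2-cycle-through-pair a'∈ a∈ ba' ab
  no-2-cycle-identified (inj₂ (a∈ , _))    (inj₂ (b∈ , _))    ab _    = no-arc-within-pair a∈ b∈ ab

merge-isOriented : ∀ {m} {G : Digraph (suc m)} → IsOriented G → {x x' : Fin (suc m)} →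
                   ¬ Adjacent G x x' → AgreeOnCommon G x x' → IsOriented (merge G x x')
merge-isOriented oG x≁x' agree = record
  { irrefl = λ _ (_ , _ , ra , ra′ , aa′) →
      no-arc-identified (represents-identified ra ra′) aa′
  ; asym   = λ _ _ (_ , _ , ra , rb , ab) (_ , _ , rb′ , ra′ , b′a′) →
      no-2-cycle-identified (represents-identified ra ra′) (represents-identified rb rb′) ab b′a′
  }
  where open IdentifiedPair oG x≁x' agree

module _ {m : ℕ} {x x' : Fin (suc m)} (x'≢x : x' ≢ x) where

  contract : Fin (suc m) → Fin m
  contract v with x' ≟ v
  ... | yes _    = punchOut x'≢x
  ... | no x'≢v  = punchOut x'≢v

  represents-contract : ∀ v → Represents x x' (punchIn x' (contract v)) v
  represents-contract v with x' ≟ v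
  ... | yes x'≡v = inj₂ (punchIn-punchOut x'≢x , sym x'≡v)
  ... | no x'≢v  = inj₁ (sym (punchIn-punchOut x'≢v))

  contract-isHom : (G : Digraph (suc m)) → IsHom G (merge G x x') contract
  contract-isHom G u v uv = u , v , represents-contract u , represents-contract v , uv

lemma4 : (m : ℕ) (H : Digraph (suc m)) → IsAbsoluteClique H →
    (x x' : Fin (suc m)) →
    OrientedChromaticNumber (push H x) m →
    x' ≢ x → ¬ Adjacent (push H x) x x' → AgreeOnCommon (push H x) x x' →
    IsAbsoluteClique (merge (push H x) x x')
lemma4 m H (oH , _) x x' (_ , minimal) x'≢x x≁x' agree =
  oM , colorable-self oM , λ k M-colorable →
    minimal k (colorable-precomp (contract-isHom x'≢x (push H x)) M-colorable)
  where
  oM : IsOriented (merge (push H x) x x')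
  oM = merge-isOriented (push-isOriented oH x) x≁x' agree
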